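{- Let $m\ge 2$ and for $S\subseteq\mathbb{Z}_m$ let $S^c$ denote the $\mathbb{Z}_m$-indexed matrix with $(i,j)$ entry $1-2\chi_S(j-i)$. (i) Suppose $B,D\subseteq\mathbb{Z}_m$ are $2$-$\{m;k,r;\mu\}$ ASDS, and let $A=\{a\in\mathbb{Z}_m\setminus\{0\}: N(a)=\mu\}$. Then for all $i,j\in\mathbb{Z}_m$, the $(i,j)$ entry of $B^c(B^c)^\top+D^c(D^c)^\top$ equals the $(i,j)$ entry of $4(k+r-\mu)I_m+2(m-2(k+r-\mu))J_m$ if $j-i\in A$, and the $(i,j)$ entry of $4(k+r-\mu-1)I_m+2(m-2(k+r-\mu-1))J_m$ otherwise. (ii) Conversely, let $B^c$ and $D^c$ be $m\times m$ circulant $\{\pm1\}$-matrices indexed by $\mathbb{Z}_m$ (entry $(i,j)$ depending only on $j-i$), let $k$ (resp. $r$) be the number of $-1$s in each row of $B^c$ (resp. $D^c$), and suppose there are an integer $\mu$ and a set $A\subseteq\mathbb{Z}_m\setminus\{0\}$ such that $B^c(B^c)^\top+D^c(D^c)^\top$ is as described in (i). Then the subsets $B=\{j: (B^c)_{0,j}=-1\}$ and $D=\{j:(D^c)_{0,j}=-1\}$ of $\mathbb{Z}_m$ determined by the first rows are $2$-$\{m;k,r;\mu\}$ ASDS.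
   Context: $\chi_S$ is the characteristic function of $S$; $I_m$ is the identity and $J_m$ the all-ones $m\times m$ matrix. For $B,D\subseteq\mathbb{Z}_m$ and $a\in\mathbb{Z}_m$, $N(a)=|\{(x,x')\in B\times B:x-x'\equiv a\bmod m\}|+|\{(y,y')\in D\times D:y-y'\equiv a\bmod m\}|$. $B,D$ are $2$-$\{m;k_1,k_2;\mu\}$ ASDS (almost supplementary difference sets) if $|B|=k_1$, $|D|=k_2$ and $N(a)\in\{\mu,\mu+1\}$ for every $a\in\mathbb{Z}_m\setminus\{0\}$. -}

module Defs where

open import Data.Nat as ℕ using (ℕ; NonZero)
open import Data.Nat.DivMod using (_mod_)
open import Data.Integer as ℤ using (ℤ; +_; -_; _-_)
open import Data.Fin as Fin using (Fin; toℕ)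
import Data.Fin.Properties as FinP
open import Data.Fin.Subset using (Subset; _∈_; ∣_∣)
open import Data.Fin.Subset.Properties using (_∈?_)
open import Data.List using (List; length; filter; cartesianProduct; foldr; map)
open import Data.List.Base using (allFin)
open import Data.Vec using (tabulate)
open import Data.Product using (_×_; _,_)
open import Data.Sum using (_⊎_)
open import Data.Bool using (if_then_else_)
open import Relation.Nullary using (¬_; does)
open import Relation.Nullary.Decidable using (_×-dec_)
open import Relation.Binary.PropositionalEquality using (_≡_; _≢_)
import Data.Integer.Properties as ℤP

-- ℤ_m is modelled as Fin m with arithmetic mod m.

zeroₘ : (m : ℕ) .{{_ : NonZero m}} → Fin m
zeroₘ m = 0 mod m

sub : (m : ℕ) .{{_ : NonZero m}} → Fin m → Fin m → Fin m
sub m x y = (toℕ x ℕ.+ (m ℕ.∸ toℕ y)) mod m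

diffCount : (m : ℕ) .{{_ : NonZero m}} → Subset m → Fin m → ℕ
diffCount m S a =
  length (filter (λ p → (Data.Product.proj₁ p ∈? S) ×-dec ((Data.Product.proj₂ p ∈? S)
                         ×-dec (sub m (Data.Product.proj₁ p) (Data.Product.proj₂ p) FinP.≟ a)))
                 (cartesianProduct (allFin m) (allFin m)))

N : (m : ℕ) .{{_ : NonZero m}} → Subset m → Subset m → Fin m → ℕ
N m B D a = diffCount m B a ℕ.+ diffCount m D a

IsASDS : (m : ℕ) .{{_ : NonZero m}} → Subset m → Subset m → ℕ → ℕ → ℤ → Set
IsASDS m B D k₁ k₂ μ =
  ∣ B ∣ ≡ k₁ × ∣ D ∣ ≡ k₂ ×
  (∀ (a : Fin m) → a ≢ zeroₘ m →
     (+ N m B D a ≡ μ) ⊎ (+ N m B D a ≡ μ ℤ.+ + 1))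

Mat : ℕ → Set
Mat m = Fin m → Fin m → ℤ

Σℤ : (m : ℕ) → (Fin m → ℤ) → ℤ
Σℤ m f = foldr ℤ._+_ (+ 0) (map f (allFin m))

infix 30 _·ᵀ
infixl 20 _⊕_
infix 40 _ᶜ
_·ᵀ : {m : ℕ} → Mat m → Mat m
_·ᵀ {m} M i j = Σℤ m (λ l → M i l ℤ.* M j l)

_⊕_ : {m : ℕ} → Mat m → Mat m → Mat m
(M ⊕ M') i j = M i j ℤ.+ M' i j

χ : {m : ℕ} → Subset m → Fin m → ℤ
χ S x = if does (x ∈? S) then + 1 else + 0

_ᶜ : {m : ℕ} .{{_ : NonZero m}} → Subset m → Mat m
_ᶜ {m} S i j = + 1 - + 2 ℤ.* χ S (sub m j i)

I : (m : ℕ) → Mat m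
I m i j = if does (i FinP.≟ j) then + 1 else + 0

J : (m : ℕ) → Mat m
J m i j = + 1

T : (m : ℕ) → ℤ → Mat m
T m c i j = + 4 ℤ.* c ℤ.* I m i j ℤ.+ + 2 ℤ.* (+ m - + 2 ℤ.* c) ℤ.* J m i j

Described : (m : ℕ) .{{_ : NonZero m}} → Mat m → ℕ → ℕ → ℤ → (Fin m → Set) → Set
Described m G k r μ A =
  ∀ (i j : Fin m) →
    (A (sub m j i) → G i j ≡ T m (+ k ℤ.+ + r - μ) i j) ×
    (¬ A (sub m j i) → G i j ≡ T m (+ k ℤ.+ + r - μ - + 1) i j)

negCount : {m : ℕ} → Mat m → Fin m → ℕ
negCount {m} M i = length (filter (λ j → M i j ℤP.≟ - + 1) (allFin m))

firstRowSet : (m : ℕ) .{{_ : NonZero m}} → Mat m → Subset m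
firstRowSet m M = tabulate (λ j → does (M (zeroₘ m) j ℤP.≟ - + 1))

-- For S ⊆ ℤ_m, expanding (1 − 2χ(l − i))(1 − 2χ(l − j)) and summing over l, using that
-- l ↦ l − i permutes ℤ_m, gives (S^c (S^c)ᵀ)_{ij} = m − 4|S| + 4·|{(x,x′) ∈ S² : x − x′ = j − i}|.
-- Hence the (i,j) entry of B^c(B^c)ᵀ + D^c(D^c)ᵀ is 2m − 4(|B| + |D|) + 4N(j − i). On the diagonal
-- N(0) = |B| + |D| makes this 2m, the diagonal of every 4cI + 2(m − 2c)J; off the diagonal it
-- equals 2m − 4c exactly when N(j − i) = |B| + |D| − c, which gives both directions, once a
-- circulant ±1 matrix is recognised as S^c for the set S of −1 positions in its first row.
module Submission where

open import Defs
open import Data.Nat as ℕ using (ℕ; NonZero; _≤_; _%_)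
import Data.Nat.Properties as ℕP
open import Data.Nat.DivMod using (_mod_; %-distribˡ-+; [m+n]%n≡m%n; m%n<n; m%n%n≡m%n; m<n⇒m%n≡m)
open import Data.Integer using (ℤ; +_; -_; _+_; _*_; _-_)
import Data.Integer.Properties as ℤP
open import Data.Integer.Tactic.RingSolver using (solve-∀)
open import Data.Fin using (Fin; toℕ; zero; suc; punchIn)
import Data.Fin.Properties as FinP
open import Data.Fin.Permutation using (Permutation; permutation)
open import Data.Fin.Subset using (Subset; _∈_; ∣_∣; inside; outside)
open import Data.Fin.Subset.Properties using (_∈?_)
open import Data.Bool using (Bool; true; false; if_then_else_; _∧_)
open import Data.List using (List; []; _∷_; _++_; length; filter; map; foldr; cartesianProduct; tabulate)
open import Data.List.Base using (allFin)
import Data.List.Properties as ListP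
import Data.Vec as Vec
open import Data.Product using (_×_; _,_; proj₁; proj₂)
open import Data.Sum using (_⊎_; inj₁; inj₂)
open import Data.Empty using (⊥-elim)
open import Function using (_∘_; _⇔_; mk⇔; Equivalence)
open import Relation.Nullary using (Dec; yes; no; does; ¬_)
open import Relation.Nullary.Decidable using (_×-dec_; dec-true; dec-false; does-⇔)
open import Relation.Unary using (Decidable)
open import Relation.Binary.PropositionalEquality
open import Algebra.Properties.Semiring.Sum ℤP.+-*-semiring
  using (sum; sum-cong-≗; sum-remove; sum-replicate-zero; ∑-distrib-+; ∑-permute; *-distribˡ-sum)

-- χ S x and I m i j unfold to 𝟙 (does …).
𝟙 : Bool → ℤ
𝟙 b = if b then + 1 else + 0

𝟙-∧ : ∀ b c → 𝟙 (b ∧ c) ≡ 𝟙 b * 𝟙 c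
𝟙-∧ false c = refl
𝟙-∧ true  c = sym (ℤP.*-identityˡ (𝟙 c))

𝟙-idem : ∀ b → 𝟙 b * 𝟙 b ≡ 𝟙 b
𝟙-idem false = refl
𝟙-idem true  = refl

listSum : List ℤ → ℤ
listSum = foldr _+_ (+ 0)

listSum-++ : ∀ xs ys → listSum (xs ++ ys) ≡ listSum xs + listSum ys
listSum-++ []       ys = sym (ℤP.+-identityˡ _)
listSum-++ (x ∷ xs) ys = trans (cong (_+_ x) (listSum-++ xs ys)) (sym (ℤP.+-assoc x _ _))

+length-filter : ∀ {a p} {A : Set a} {P : A → Set p} (P? : Decidable P) (xs : List A) →
                 + length (filter P? xs) ≡ listSum (map (𝟙 ∘ does ∘ P?) xs)
+length-filter P? []       = refl
+length-filter P? (x ∷ xs) with does (P? x)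
... | true  = cong (_+_ (+ 1)) (+length-filter P? xs)
... | false = trans (+length-filter P? xs) (sym (ℤP.+-identityˡ _))

listSum-cartesianProduct : ∀ {A B : Set} (h : A × B → ℤ) (xs : List A) (ys : List B) →
  listSum (map h (cartesianProduct xs ys)) ≡ listSum (map (λ x → listSum (map (λ y → h (x , y)) ys)) xs)
listSum-cartesianProduct h []       ys = refl
listSum-cartesianProduct h (x ∷ xs) ys = begin
  listSum (map h (map (x ,_) ys ++ cartesianProduct xs ys))
    ≡⟨ cong listSum (ListP.map-++ h (map (x ,_) ys) _) ⟩
  listSum (map h (map (x ,_) ys) ++ map h (cartesianProduct xs ys))
    ≡⟨ listSum-++ (map h (map (x ,_) ys)) _ ⟩
  listSum (map h (map (x ,_) ys)) + listSum (map h (cartesianProduct xs ys))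
    ≡⟨ cong₂ _+_ (cong listSum (sym (ListP.map-∘ ys))) (listSum-cartesianProduct h xs ys) ⟩
  listSum (map (λ y → h (x , y)) ys) + listSum (map (λ x → listSum (map (λ y → h (x , y)) ys)) xs) ∎
  where open ≡-Reasoning

listSum-tabulate : ∀ {n} (f : Fin n → ℤ) → listSum (tabulate f) ≡ sum f
listSum-tabulate {ℕ.zero}  f = refl
listSum-tabulate {ℕ.suc n} f = cong (_+_ (f zero)) (listSum-tabulate (f ∘ suc))

Σℤ≡sum : ∀ n (f : Fin n → ℤ) → Σℤ n f ≡ sum f
Σℤ≡sum n f = trans (cong listSum (ListP.map-tabulate (λ x → x) f)) (listSum-tabulate f)

sum-1 : ∀ n → sum {n} (λ _ → + 1) ≡ + n
sum-1 ℕ.zero    = refl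
sum-1 (ℕ.suc n) = cong (_+_ (+ 1)) (sum-1 n)

sum-*-𝟙-≟ : ∀ {n} (g : Fin n → ℤ) c → sum (λ y → g y * 𝟙 (does (y FinP.≟ c))) ≡ g c
sum-*-𝟙-≟ {ℕ.suc n} g c = begin
  sum t                         ≡⟨ sum-remove t ⟩
  t c + sum (λ y → t (punchIn c y)) ≡⟨ cong₂ _+_ diagonal (sum-cong-≗ offDiagonal) ⟩
  g c + sum {n} (λ _ → + 0)     ≡⟨ cong (_+_ (g c)) (sum-replicate-zero n) ⟩
  g c + + 0                     ≡⟨ ℤP.+-identityʳ (g c) ⟩
  g c                           ∎
  where
  open ≡-Reasoning
  t : Fin (ℕ.suc n) → ℤ
  t y = g y * 𝟙 (does (y FinP.≟ c))
  diagonal : t c ≡ g c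
  diagonal = trans (cong (λ b → g c * 𝟙 b) (dec-true (c FinP.≟ c) refl)) (ℤP.*-identityʳ (g c))
  offDiagonal : ∀ y → t (punchIn c y) ≡ + 0
  offDiagonal y = trans (cong (λ b → g (punchIn c y) * 𝟙 b) (dec-false (punchIn c y FinP.≟ c) (FinP.punchInᵢ≢i c y)))
                        (ℤP.*-zeroʳ (g (punchIn c y)))

+∣∣≡sum-χ : ∀ {n} (p : Subset n) → + ∣ p ∣ ≡ sum (χ p)
+∣∣≡sum-χ Vec.[]            = refl
+∣∣≡sum-χ (inside  Vec.∷ p) = cong (_+_ (+ 1)) (+∣∣≡sum-χ p)
+∣∣≡sum-χ (outside Vec.∷ p) = trans (+∣∣≡sum-χ p) (sym (ℤP.+-identityˡ _))

χ-tabulate : ∀ {n} (g : Fin n → Bool) x → χ (Vec.tabulate g) x ≡ 𝟙 (g x)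
χ-tabulate g zero with g zero
... | true  = refl
... | false = refl
χ-tabulate g (suc x) = χ-tabulate (g ∘ suc) x

x-4k+4n≡x-4[k-ν]⇔n≡ν : ∀ x k n ν → (x - + 4 * k + + 4 * n ≡ x - + 4 * (k - ν)) ⇔ (n ≡ ν)
x-4k+4n≡x-4[k-ν]⇔n≡ν x k n ν = mk⇔ cancel (λ { refl → regroup x k n })
  where
  regroup : ∀ x k n → x - + 4 * k + + 4 * n ≡ x - + 4 * (k - n)
  regroup = solve-∀
  isolate : ∀ x k n → + 4 * n ≡ (x - + 4 * k + + 4 * n) + (+ 4 * k - x)
  isolate = solve-∀
  isolate′ : ∀ x k ν → x - + 4 * (k - ν) + (+ 4 * k - x) ≡ + 4 * ν
  isolate′ = solve-∀
  cancel : x - + 4 * k + + 4 * n ≡ x - + 4 * (k - ν) → n ≡ ν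
  cancel e = ℤP.*-cancelˡ-≡ (+ 4) n ν
    (trans (isolate x k n) (trans (cong (_+ (+ 4 * k - x)) e) (isolate′ x k ν)))

k-μ-1≡k-[μ+1] : ∀ (k μ : ℤ) → k - μ - + 1 ≡ k - (μ + + 1)
k-μ-1≡k-[μ+1] = solve-∀

±1≡1-2𝟙[≡-1] : ∀ {v} → (v ≡ + 1) ⊎ (v ≡ - + 1) → v ≡ + 1 - + 2 * 𝟙 (does (v ℤP.≟ - + 1))
±1≡1-2𝟙[≡-1] (inj₁ refl) = refl
±1≡1-2𝟙[≡-1] (inj₂ refl) = refl

·ᵀ-cong : ∀ {m} {M M′ : Mat m} → (∀ i l → M i l ≡ M′ i l) → ∀ i j → (M ·ᵀ) i j ≡ (M′ ·ᵀ) i j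
·ᵀ-cong {m} M≡M′ i j = cong listSum (ListP.map-cong (λ l → cong₂ _*_ (M≡M′ i l) (M≡M′ j l)) (allFin m))

module _ (m : ℕ) .{{_ : NonZero m}} where

  infix 4 _≡ₘ_
  _≡ₘ_ : ℕ → ℕ → Set
  a ≡ₘ b = a % m ≡ b % m

  ≡ₘ-+ʳ : ∀ {a b} c → a ≡ₘ b → a ℕ.+ c ≡ₘ b ℕ.+ c
  ≡ₘ-+ʳ {a} {b} c a≡b = begin
    (a ℕ.+ c) % m           ≡⟨ %-distribˡ-+ a c m ⟩
    (a % m ℕ.+ c % m) % m   ≡⟨ cong (λ t → (t ℕ.+ c % m) % m) a≡b ⟩
    (b % m ℕ.+ c % m) % m   ≡⟨ %-distribˡ-+ b c m ⟨
    (b ℕ.+ c) % m           ∎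
    where open ≡-Reasoning

  ≡ₘ-+ˡ : ∀ {a b} c → a ≡ₘ b → c ℕ.+ a ≡ₘ c ℕ.+ b
  ≡ₘ-+ˡ {a} {b} c a≡b =
    trans (cong (_% m) (ℕP.+-comm c a)) (trans (≡ₘ-+ʳ c a≡b) (cong (_% m) (ℕP.+-comm b c)))

  -- Adding m ∸ c undoes adding c.
  +-cancelʳ-≡ₘ : ∀ {a b c} → c ≤ m → a ℕ.+ c ≡ₘ b ℕ.+ c → a ≡ₘ b
  +-cancelʳ-≡ₘ {a} {b} {c} c≤m a+c≡b+c = begin
    a % m                            ≡⟨ [m+n]%n≡m%n a m ⟨
    (a ℕ.+ m) % m                    ≡⟨ cong (_% m) (reassociate a) ⟩
    (a ℕ.+ c ℕ.+ (m ℕ.∸ c)) % m      ≡⟨ ≡ₘ-+ʳ (m ℕ.∸ c) a+c≡b+c ⟩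
    (b ℕ.+ c ℕ.+ (m ℕ.∸ c)) % m      ≡⟨ cong (_% m) (reassociate b) ⟨
    (b ℕ.+ m) % m                    ≡⟨ [m+n]%n≡m%n b m ⟩
    b % m                            ∎
    where
    open ≡-Reasoning
    reassociate : ∀ x → x ℕ.+ m ≡ x ℕ.+ c ℕ.+ (m ℕ.∸ c)
    reassociate x = trans (cong (x ℕ.+_) (sym (ℕP.m+[n∸m]≡n c≤m))) (sym (ℕP.+-assoc x c (m ℕ.∸ c)))

  toℕ-mod : ∀ n → toℕ (n mod m) ≡ₘ n
  toℕ-mod n = trans (cong (_% m) (FinP.toℕ-fromℕ< (m%n<n n m))) (m%n%n≡m%n n m)

  toℕ-%-id : ∀ (x : Fin m) → toℕ x % m ≡ toℕ x
  toℕ-%-id x = m<n⇒m%n≡m (FinP.toℕ<n x)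

  toℕ-injectiveₘ : ∀ {x y : Fin m} → toℕ x ≡ₘ toℕ y → x ≡ y
  toℕ-injectiveₘ {x} {y} x≡y = FinP.toℕ-injective (trans (sym (toℕ-%-id x)) (trans x≡y (toℕ-%-id y)))

  toℕ-zeroₘ : toℕ (zeroₘ m) ≡ 0
  toℕ-zeroₘ = trans (sym (toℕ-%-id (zeroₘ m))) (trans (toℕ-mod 0) (m<n⇒m%n≡m (ℕ.>-nonZero⁻¹ m)))

  sub-+ : ∀ x y → toℕ (sub m x y) ℕ.+ toℕ y ≡ₘ toℕ x
  sub-+ x y = begin
    (toℕ (sub m x y) ℕ.+ toℕ y) % m             ≡⟨ ≡ₘ-+ʳ (toℕ y) (toℕ-mod (toℕ x ℕ.+ (m ℕ.∸ toℕ y))) ⟩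
    (toℕ x ℕ.+ (m ℕ.∸ toℕ y) ℕ.+ toℕ y) % m     ≡⟨ cong (_% m) (ℕP.+-assoc (toℕ x) _ _) ⟩
    (toℕ x ℕ.+ (m ℕ.∸ toℕ y ℕ.+ toℕ y)) % m     ≡⟨ cong (λ t → (toℕ x ℕ.+ t) % m) (ℕP.m∸n+n≡m (ℕP.<⇒≤ (FinP.toℕ<n y))) ⟩
    (toℕ x ℕ.+ m) % m                           ≡⟨ [m+n]%n≡m%n (toℕ x) m ⟩
    toℕ x % m                                   ∎
    where open ≡-Reasoning

  sub-unique : ∀ {x y z} → toℕ z ℕ.+ toℕ y ≡ₘ toℕ x → sub m x y ≡ z
  sub-unique {x} {y} {z} z+y≡x =
    toℕ-injectiveₘ (+-cancelʳ-≡ₘ (ℕP.<⇒≤ (FinP.toℕ<n y)) (trans (sub-+ x y) (sym z+y≡x)))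

  sub-self : ∀ x → sub m x x ≡ zeroₘ m
  sub-self x = sub-unique (cong (λ t → (t ℕ.+ toℕ x) % m) toℕ-zeroₘ)

  sub-identityʳ : ∀ x → sub m x (zeroₘ m) ≡ x
  sub-identityʳ x = sub-unique (cong (_% m) (trans (cong (toℕ x ℕ.+_) toℕ-zeroₘ) (ℕP.+-identityʳ (toℕ x))))

  sub≡zeroₘ⇒≡ : ∀ {x y} → sub m x y ≡ zeroₘ m → y ≡ x
  sub≡zeroₘ⇒≡ {x} {y} y-x≡0 =
    toℕ-injectiveₘ (begin
      toℕ y % m                               ≡⟨ cong (λ t → (t ℕ.+ toℕ y) % m) toℕ-zeroₘ ⟨
      (toℕ (zeroₘ m) ℕ.+ toℕ y) % m           ≡⟨ cong (λ t → (toℕ t ℕ.+ toℕ y) % m) y-x≡0 ⟨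
      (toℕ (sub m x y) ℕ.+ toℕ y) % m         ≡⟨ sub-+ x y ⟩
      toℕ x % m                               ∎)
    where open ≡-Reasoning

  sub-swap : ∀ {x y z} → sub m x y ≡ z → sub m x z ≡ y
  sub-swap {x} {y} refl = sub-unique (trans (cong (_% m) (ℕP.+-comm (toℕ y) _)) (sub-+ x y))

  sub-sub-sub : ∀ l i j → sub m (sub m l i) (sub m j i) ≡ sub m l j
  sub-sub-sub l i j = sub-unique (+-cancelʳ-≡ₘ (ℕP.<⇒≤ (FinP.toℕ<n i)) (begin
    (toℕ (sub m l j) ℕ.+ toℕ (sub m j i) ℕ.+ toℕ i) % m    ≡⟨ cong (_% m) (ℕP.+-assoc (toℕ (sub m l j)) _ _) ⟩
    (toℕ (sub m l j) ℕ.+ (toℕ (sub m j i) ℕ.+ toℕ i)) % m  ≡⟨ ≡ₘ-+ˡ (toℕ (sub m l j)) (sub-+ j i) ⟩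
    (toℕ (sub m l j) ℕ.+ toℕ j) % m                      ≡⟨ sub-+ l j ⟩
    toℕ l % m                                            ≡⟨ sub-+ l i ⟨
    (toℕ (sub m l i) ℕ.+ toℕ i) % m                      ∎))
    where open ≡-Reasoning

  addₘ : Fin m → Fin m → Fin m
  addₘ x y = (toℕ x ℕ.+ toℕ y) mod m

  translation : Fin m → Permutation m m
  translation i = permutation (λ l → sub m l i) (λ x → addₘ x i)
    (λ x → sub-unique (sym (toℕ-mod _)))
    (λ l → toℕ-injectiveₘ (trans (toℕ-mod _) (sub-+ l i)))

  sum-translate : ∀ (f : Fin m → ℤ) i → sum (λ l → f (sub m l i)) ≡ sum f
  sum-translate f i = sym (∑-permute f (translation i))

  +diffCount≡sum : ∀ (S : Subset m) a → + diffCount m S a ≡ sum (λ x → χ S x * χ S (sub m x a))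
  +diffCount≡sum S a = begin
    + diffCount m S a
      ≡⟨ +length-filter P? (cartesianProduct (allFin m) (allFin m)) ⟩
    listSum (map (𝟙 ∘ does ∘ P?) (cartesianProduct (allFin m) (allFin m)))
      ≡⟨ listSum-cartesianProduct (𝟙 ∘ does ∘ P?) (allFin m) (allFin m) ⟩
    Σℤ m (λ x → Σℤ m (λ y → 𝟙 (does (P? (x , y)))))
      ≡⟨ Σℤ≡sum m _ ⟩
    sum (λ x → Σℤ m (λ y → 𝟙 (does (P? (x , y)))))
      ≡⟨ sum-cong-≗ (λ x → trans (Σℤ≡sum m _) (sum-cong-≗ (factor x))) ⟩
    sum (λ x → sum (λ y → χ S x * (χ S y * 𝟙 (does (y FinP.≟ sub m x a)))))
      ≡⟨ sum-cong-≗ (λ x → sym (*-distribˡ-sum (χ S x) (λ y → χ S y * 𝟙 (does (y FinP.≟ sub m x a))))) ⟩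
    sum (λ x → χ S x * sum (λ y → χ S y * 𝟙 (does (y FinP.≟ sub m x a))))
      ≡⟨ sum-cong-≗ (λ x → cong (χ S x *_) (sum-*-𝟙-≟ (χ S) (sub m x a))) ⟩
    sum (λ x → χ S x * χ S (sub m x a)) ∎
    where
    open ≡-Reasoning
    P? : (p : Fin m × Fin m) → Dec ((proj₁ p ∈ S) × ((proj₂ p ∈ S) × (sub m (proj₁ p) (proj₂ p) ≡ a)))
    P? p = (proj₁ p ∈? S) ×-dec ((proj₂ p ∈? S) ×-dec (sub m (proj₁ p) (proj₂ p) FinP.≟ a))
    factor : ∀ x y → 𝟙 (does (P? (x , y))) ≡ χ S x * (χ S y * 𝟙 (does (y FinP.≟ sub m x a)))
    factor x y = trans (𝟙-∧ (does (x ∈? S)) _) (cong (χ S x *_) (trans (𝟙-∧ (does (y ∈? S)) _)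
      (cong (λ b → χ S y * 𝟙 b) (does-⇔ (mk⇔ (sym ∘ sub-swap {x} {y}) (sub-swap {x} {a} ∘ sym)) (sub m x y FinP.≟ a) (y FinP.≟ sub m x a)))))

  diffCount-zeroₘ : ∀ (S : Subset m) → diffCount m S (zeroₘ m) ≡ ∣ S ∣
  diffCount-zeroₘ S = ℤP.+-injective (begin
    + diffCount m S (zeroₘ m)                        ≡⟨ +diffCount≡sum S (zeroₘ m) ⟩
    sum (λ x → χ S x * χ S (sub m x (zeroₘ m)))      ≡⟨ sum-cong-≗ (λ x → cong (λ y → χ S x * χ S y) (sub-identityʳ x)) ⟩
    sum (λ x → χ S x * χ S x)                        ≡⟨ sum-cong-≗ (λ x → 𝟙-idem (does (x ∈? S))) ⟩
    sum (χ S)                                        ≡⟨ +∣∣≡sum-χ S ⟨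
    + ∣ S ∣                                          ∎)
    where open ≡-Reasoning

  sum-χ-translate : ∀ (S : Subset m) i → sum (λ l → χ S (sub m l i)) ≡ + ∣ S ∣
  sum-χ-translate S i = trans (sum-translate (χ S) i) (sym (+∣∣≡sum-χ S))

  sum-χχ-translate : ∀ (S : Subset m) i j →
    sum (λ l → χ S (sub m l i) * χ S (sub m l j)) ≡ + diffCount m S (sub m j i)
  sum-χχ-translate S i j = begin
    sum (λ l → χ S (sub m l i) * χ S (sub m l j))
      ≡⟨ sum-cong-≗ (λ l → cong (λ t → χ S (sub m l i) * χ S t) (sym (sub-sub-sub l i j))) ⟩
    sum (λ l → autocorrelation (sub m l i))   ≡⟨ sum-translate autocorrelation i ⟩
    sum autocorrelation                      ≡⟨ +diffCount≡sum S (sub m j i) ⟨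
    + diffCount m S (sub m j i)              ∎
    where
    open ≡-Reasoning
    autocorrelation : Fin m → ℤ
    autocorrelation x = χ S x * χ S (sub m x (sub m j i))

  ᶜ·ᵀ-entry : ∀ (S : Subset m) i j →
    ((S ᶜ) ·ᵀ) i j ≡ + m - + 4 * + ∣ S ∣ + + 4 * + diffCount m S (sub m j i)
  ᶜ·ᵀ-entry S i j = begin
    ((S ᶜ) ·ᵀ) i j
      ≡⟨ Σℤ≡sum m _ ⟩
    sum (λ l → (+ 1 - + 2 * a l) * (+ 1 - + 2 * b l))
      ≡⟨ sum-cong-≗ (λ l → expand (a l) (b l)) ⟩
    sum (λ l → + 1 + (- + 2 * a l + (- + 2 * b l + + 4 * (a l * b l))))
      ≡⟨ ∑-distrib-+ {m} (λ _ → + 1) _ ⟩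
    sum {m} (λ _ → + 1) + sum (λ l → - + 2 * a l + (- + 2 * b l + + 4 * (a l * b l)))
      ≡⟨ cong (_+_ (sum {m} (λ _ → + 1))) (∑-distrib-+ (λ l → - + 2 * a l) _) ⟩
    sum {m} (λ _ → + 1) + (sum (λ l → - + 2 * a l) + sum (λ l → - + 2 * b l + + 4 * (a l * b l)))
      ≡⟨ cong (λ t → sum {m} (λ _ → + 1) + (sum (λ l → - + 2 * a l) + t)) (∑-distrib-+ (λ l → - + 2 * b l) _) ⟩
    sum {m} (λ _ → + 1) + (sum (λ l → - + 2 * a l) + (sum (λ l → - + 2 * b l) + sum (λ l → + 4 * (a l * b l))))
      ≡⟨ cong₂ (λ s t → s + (t + (sum (λ l → - + 2 * b l) + sum (λ l → + 4 * ab l)))) (sum-1 m) (sym (*-distribˡ-sum (- + 2) a)) ⟩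
    + m + (- + 2 * sum a + (sum (λ l → - + 2 * b l) + sum (λ l → + 4 * (a l * b l))))
      ≡⟨ cong₂ (λ s t → + m + (- + 2 * sum a + (s + t))) (sym (*-distribˡ-sum (- + 2) b)) (sym (*-distribˡ-sum (+ 4) ab)) ⟩
    + m + (- + 2 * sum a + (- + 2 * sum b + + 4 * sum ab))
      ≡⟨ cong₂ (λ s t → + m + (- + 2 * s + (- + 2 * t + + 4 * sum ab))) (sum-χ-translate S i) (sum-χ-translate S j) ⟩
    + m + (- + 2 * + ∣ S ∣ + (- + 2 * + ∣ S ∣ + + 4 * sum ab))
      ≡⟨ cong (λ t → + m + (- + 2 * + ∣ S ∣ + (- + 2 * + ∣ S ∣ + + 4 * t))) (sum-χχ-translate S i j) ⟩
    + m + (- + 2 * + ∣ S ∣ + (- + 2 * + ∣ S ∣ + + 4 * + diffCount m S (sub m j i)))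
      ≡⟨ collect (+ m) (+ ∣ S ∣) (+ diffCount m S (sub m j i)) ⟩
    + m - + 4 * + ∣ S ∣ + + 4 * + diffCount m S (sub m j i) ∎
    where
    open ≡-Reasoning
    a b ab : Fin m → ℤ
    a l = χ S (sub m l i)
    b l = χ S (sub m l j)
    ab l = a l * b l
    expand : ∀ x y → (+ 1 - + 2 * x) * (+ 1 - + 2 * y) ≡ + 1 + (- + 2 * x + (- + 2 * y + + 4 * (x * y)))
    expand = solve-∀
    collect : ∀ x s d → x + (- + 2 * s + (- + 2 * s + + 4 * d)) ≡ x - + 4 * s + + 4 * d
    collect = solve-∀

  ⊕-entry : ∀ (B D : Subset m) i j →
    ((B ᶜ) ·ᵀ ⊕ (D ᶜ) ·ᵀ) i j ≡ + 2 * + m - + 4 * (+ ∣ B ∣ + + ∣ D ∣) + + 4 * + N m B D (sub m j i)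
  ⊕-entry B D i j = begin
    ((B ᶜ) ·ᵀ ⊕ (D ᶜ) ·ᵀ) i j
      ≡⟨ cong₂ _+_ (ᶜ·ᵀ-entry B i j) (ᶜ·ᵀ-entry D i j) ⟩
    (+ m - + 4 * + ∣ B ∣ + + 4 * + diffCount m B d) + (+ m - + 4 * + ∣ D ∣ + + 4 * + diffCount m D d)
      ≡⟨ collect (+ m) (+ ∣ B ∣) (+ ∣ D ∣) (+ diffCount m B d) (+ diffCount m D d) ⟩
    + 2 * + m - + 4 * (+ ∣ B ∣ + + ∣ D ∣) + + 4 * (+ diffCount m B d + + diffCount m D d)
      ≡⟨ cong (λ t → + 2 * + m - + 4 * (+ ∣ B ∣ + + ∣ D ∣) + + 4 * t) (ℤP.pos-+ (diffCount m B d) _) ⟨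
    + 2 * + m - + 4 * (+ ∣ B ∣ + + ∣ D ∣) + + 4 * + N m B D d ∎
    where
    open ≡-Reasoning
    d = sub m j i
    collect : ∀ x b d p q → (x - + 4 * b + + 4 * p) + (x - + 4 * d + + 4 * q) ≡ + 2 * x - + 4 * (b + d) + + 4 * (p + q)
    collect = solve-∀

  T-diagonal : ∀ c i → T m c i i ≡ + 2 * + m
  T-diagonal c i = trans (cong (λ b → + 4 * c * 𝟙 b + + 2 * (+ m - + 2 * c) * + 1) (dec-true (i FinP.≟ i) refl))
                         (simplify c (+ m))
    where
    simplify : ∀ c x → + 4 * c * + 1 + + 2 * (x - + 2 * c) * + 1 ≡ + 2 * x
    simplify = solve-∀

  T-offDiagonal : ∀ c {i j} → i ≢ j → T m c i j ≡ + 2 * + m - + 4 * c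
  T-offDiagonal c {i} {j} i≢j = trans (cong (λ b → + 4 * c * 𝟙 b + + 2 * (+ m - + 2 * c) * + 1) (dec-false (i FinP.≟ j) i≢j))
                                      (simplify c (+ m))
    where
    simplify : ∀ c x → + 4 * c * + 0 + + 2 * (x - + 2 * c) * + 1 ≡ + 2 * x - + 4 * c
    simplify = solve-∀

  ≡T-offDiagonal⇔ : ∀ k n ν {i j} → i ≢ j →
    (+ 2 * + m - + 4 * k + + 4 * n ≡ T m (k - ν) i j) ⇔ (n ≡ ν)
  ≡T-offDiagonal⇔ k n ν i≢j rewrite T-offDiagonal (k - ν) i≢j = x-4k+4n≡x-4[k-ν]⇔n≡ν (+ 2 * + m) k n ν

  ⊕-diagonal : ∀ (B D : Subset m) c {i j} → i ≡ j → ((B ᶜ) ·ᵀ ⊕ (D ᶜ) ·ᵀ) i j ≡ T m c i j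
  ⊕-diagonal B D c {i} refl = begin
    ((B ᶜ) ·ᵀ ⊕ (D ᶜ) ·ᵀ) i i
      ≡⟨ ⊕-entry B D i i ⟩
    + 2 * + m - + 4 * K + + 4 * + N m B D (sub m i i)
      ≡⟨ cong (λ t → + 2 * + m - + 4 * K + + 4 * + N m B D t) (sub-self i) ⟩
    + 2 * + m - + 4 * K + + 4 * + (diffCount m B (zeroₘ m) ℕ.+ diffCount m D (zeroₘ m))
      ≡⟨ cong (λ t → + 2 * + m - + 4 * K + + 4 * t)
              (trans (cong₂ (λ p q → + (p ℕ.+ q)) (diffCount-zeroₘ B) (diffCount-zeroₘ D)) (ℤP.pos-+ ∣ B ∣ ∣ D ∣)) ⟩
    + 2 * + m - + 4 * K + + 4 * K
      ≡⟨ cancel (+ 2 * + m) K ⟩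
    + 2 * + m
      ≡⟨ T-diagonal c i ⟨
    T m c i i ∎
    where
    open ≡-Reasoning
    K = + ∣ B ∣ + + ∣ D ∣
    cancel : ∀ x k → x - + 4 * k + + 4 * k ≡ x
    cancel = solve-∀

  asds⇒described : ∀ (B D : Subset m) k r μ → IsASDS m B D k r μ →
    Described m ((B ᶜ) ·ᵀ ⊕ (D ᶜ) ·ᵀ) k r μ (λ a → (a ≢ zeroₘ m) × (+ N m B D a ≡ μ))
  asds⇒described B D _ _ μ (refl , refl , N∈μ) i j = entryOnA , entryOffA
    where
    K = + ∣ B ∣ + + ∣ D ∣
    d = sub m j i
    offDiagonal : ∀ ν → + N m B D d ≡ ν → i ≢ j → ((B ᶜ) ·ᵀ ⊕ (D ᶜ) ·ᵀ) i j ≡ T m (K - ν) i j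
    offDiagonal ν Nd≡ν i≢j = trans (⊕-entry B D i j) (Equivalence.from (≡T-offDiagonal⇔ K _ ν i≢j) Nd≡ν)
    entryOnA : (d ≢ zeroₘ m) × (+ N m B D d ≡ μ) → ((B ᶜ) ·ᵀ ⊕ (D ᶜ) ·ᵀ) i j ≡ T m (K - μ) i j
    entryOnA (d≢0 , Nd≡μ) = offDiagonal μ Nd≡μ (λ { refl → d≢0 (sub-self i) })
    entryOffA : ¬ ((d ≢ zeroₘ m) × (+ N m B D d ≡ μ)) → ((B ᶜ) ·ᵀ ⊕ (D ᶜ) ·ᵀ) i j ≡ T m (K - μ - + 1) i j
    entryOffA ¬onA = byDiagonality (i FinP.≟ j)
      where
      byDiagonality : Dec (i ≡ j) → ((B ᶜ) ·ᵀ ⊕ (D ᶜ) ·ᵀ) i j ≡ T m (K - μ - + 1) i j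
      byDiagonality (yes i≡j) = ⊕-diagonal B D (K - μ - + 1) i≡j
      byDiagonality (no i≢j) with N∈μ d (i≢j ∘ sub≡zeroₘ⇒≡)
      ... | inj₁ Nd≡μ   = ⊥-elim (¬onA (i≢j ∘ sub≡zeroₘ⇒≡ , Nd≡μ))
      ... | inj₂ Nd≡μ+1 = trans (offDiagonal (μ + + 1) Nd≡μ+1 i≢j) (cong (λ c → T m c i j) (sym (k-μ-1≡k-[μ+1] K μ)))

  IsPlusMinusOne : Mat m → Set
  IsPlusMinusOne M = ∀ i j → (M i j ≡ + 1) ⊎ (M i j ≡ - + 1)

  IsCirculant : Mat m → Set
  IsCirculant M = ∀ i j i′ j′ → sub m j i ≡ sub m j′ i′ → M i j ≡ M i′ j′

  circulant≡firstRowSetᶜ : ∀ (M : Mat m) → IsPlusMinusOne M → IsCirculant M →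
    ∀ i l → M i l ≡ (firstRowSet m M ᶜ) i l
  circulant≡firstRowSetᶜ M ±1 circulant i l = begin
    M i l
      ≡⟨ circulant i l (zeroₘ m) (sub m l i) (sym (sub-identityʳ (sub m l i))) ⟩
    M (zeroₘ m) (sub m l i)
      ≡⟨ ±1≡1-2𝟙[≡-1] (±1 (zeroₘ m) (sub m l i)) ⟩
    + 1 - + 2 * 𝟙 (does (M (zeroₘ m) (sub m l i) ℤP.≟ - + 1))
      ≡⟨ cong (λ t → + 1 - + 2 * t) (χ-tabulate (λ x → does (M (zeroₘ m) x ℤP.≟ - + 1)) (sub m l i)) ⟨
    (firstRowSet m M ᶜ) i l ∎
    where open ≡-Reasoning

  negCount≡∣firstRowSet∣ : ∀ (M : Mat m) → negCount M (zeroₘ m) ≡ ∣ firstRowSet m M ∣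
  negCount≡∣firstRowSet∣ M = ℤP.+-injective (begin
    + negCount M (zeroₘ m)                ≡⟨ +length-filter isNeg? (allFin m) ⟩
    Σℤ m (𝟙 ∘ does ∘ isNeg?)              ≡⟨ Σℤ≡sum m _ ⟩
    sum (𝟙 ∘ does ∘ isNeg?)               ≡⟨ sum-cong-≗ (χ-tabulate (does ∘ isNeg?)) ⟨
    sum (χ (firstRowSet m M))             ≡⟨ +∣∣≡sum-χ (firstRowSet m M) ⟨
    + ∣ firstRowSet m M ∣                 ∎)
    where
    open ≡-Reasoning
    isNeg? : ∀ j → Dec (M (zeroₘ m) j ≡ - + 1)
    isNeg? j = M (zeroₘ m) j ℤP.≟ - + 1

  described⇒asds : ∀ (Bc Dc : Mat m) k r μ (A : Subset m) →
    IsPlusMinusOne Bc → IsPlusMinusOne Dc → IsCirculant Bc → IsCirculant Dc →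
    (∀ i → negCount Bc i ≡ k) → (∀ i → negCount Dc i ≡ r) →
    Described m (Bc ·ᵀ ⊕ Dc ·ᵀ) k r μ (λ a → a ∈ A) →
    IsASDS m (firstRowSet m Bc) (firstRowSet m Dc) k r μ
  described⇒asds Bc Dc k r μ A ±1B ±1D circB circD negB negD described = ∣B∣≡k , ∣D∣≡r , N∈μ
    where
    B = firstRowSet m Bc
    D = firstRowSet m Dc
    K = + k + + r
    0ₘ = zeroₘ m
    ∣B∣≡k : ∣ B ∣ ≡ k
    ∣B∣≡k = trans (sym (negCount≡∣firstRowSet∣ Bc)) (negB 0ₘ)
    ∣D∣≡r : ∣ D ∣ ≡ r
    ∣D∣≡r = trans (sym (negCount≡∣firstRowSet∣ Dc)) (negD 0ₘ)
    firstRow : ∀ a → (Bc ·ᵀ ⊕ Dc ·ᵀ) 0ₘ a ≡ + 2 * + m - + 4 * K + + 4 * + N m B D a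
    firstRow a = begin
      (Bc ·ᵀ ⊕ Dc ·ᵀ) 0ₘ a
        ≡⟨ cong₂ _+_ (·ᵀ-cong (circulant≡firstRowSetᶜ Bc ±1B circB) 0ₘ a)
                     (·ᵀ-cong (circulant≡firstRowSetᶜ Dc ±1D circD) 0ₘ a) ⟩
      ((B ᶜ) ·ᵀ ⊕ (D ᶜ) ·ᵀ) 0ₘ a
        ≡⟨ ⊕-entry B D 0ₘ a ⟩
      + 2 * + m - + 4 * (+ ∣ B ∣ + + ∣ D ∣) + + 4 * + N m B D (sub m a 0ₘ)
        ≡⟨ cong₂ (λ K′ x → + 2 * + m - + 4 * K′ + + 4 * + N m B D x)
                 (cong₂ (λ p q → + p + + q) ∣B∣≡k ∣D∣≡r) (sub-identityʳ a) ⟩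
      + 2 * + m - + 4 * K + + 4 * + N m B D a ∎
      where open ≡-Reasoning
    N∈μ : ∀ a → a ≢ 0ₘ → (+ N m B D a ≡ μ) ⊎ (+ N m B D a ≡ μ + + 1)
    N∈μ a a≢0 with sub m a 0ₘ ∈? A
    ... | yes a∈A = inj₁ (Equivalence.to (≡T-offDiagonal⇔ K _ μ (a≢0 ∘ sym))
                          (trans (sym (firstRow a)) (proj₁ (described 0ₘ a) a∈A)))
    ... | no  a∉A = inj₂ (Equivalence.to (≡T-offDiagonal⇔ K _ (μ + + 1) (a≢0 ∘ sym))
                          (trans (sym (firstRow a)) (trans (proj₂ (described 0ₘ a) a∉A)
                                 (cong (λ c → T m c 0ₘ a) (k-μ-1≡k-[μ+1] K μ)))))

theorem2 :
    (m : ℕ) .{{_ : NonZero m}} → 2 ≤ m →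
    -- (i)
    ((B D : Subset m) (k r : ℕ) (μ : ℤ) → IsASDS m B D k r μ →
      Described m ((B ᶜ) ·ᵀ ⊕ (D ᶜ) ·ᵀ) k r μ
        (λ a → (a ≢ zeroₘ m) × (+ N m B D a ≡ μ)))
    ×
    -- (ii)
    ((Bc Dc : Mat m) (k r : ℕ) (μ : ℤ) (A : Subset m) →
      (∀ i j → (Bc i j ≡ + 1) ⊎ (Bc i j ≡ - + 1)) →
      (∀ i j → (Dc i j ≡ + 1) ⊎ (Dc i j ≡ - + 1)) →
      (∀ i j i' j' → sub m j i ≡ sub m j' i' → Bc i j ≡ Bc i' j') →
      (∀ i j i' j' → sub m j i ≡ sub m j' i' → Dc i j ≡ Dc i' j') →
      (∀ i → negCount Bc i ≡ k) →
      (∀ i → negCount Dc i ≡ r) →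
      (∀ a → a ∈ A → a ≢ zeroₘ m) →
      Described m (Bc ·ᵀ ⊕ Dc ·ᵀ) k r μ (λ a → a ∈ A) →
      IsASDS m (firstRowSet m Bc) (firstRowSet m Dc) k r μ)
theorem2 m _ =
  asds⇒described m ,
  λ Bc Dc k r μ A ±1B ±1D circB circD negB negD _ → described⇒asds m Bc Dc k r μ A ±1B ±1D circB circD negB negD
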